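{- Let $0<\varepsilon\le 1/5$ and let $H$ be a bipartite graph with biparts $A,B$ which has $(1-\varepsilon)$-complete degree and whose edges are coloured with two colours. Then $H$ has a monochromatic component that is $((1-\varepsilon)/2)$-spanning in $H$.
   Context: A bipartite graph $H$ with biparts $A,B$ has $\gamma$-complete degree if $\deg_H(y)>\gamma|A|$ for all $y\in B$ and $\deg_H(x)>\gamma|B|$ for all $x\in A$. A subgraph with biparts $X\subseteq A$, $Y\subseteq B$ is $\gamma$-spanning if $|X|\ge\gamma|A|$ and $|Y|\ge\gamma|B|$. A monochromatic component of colour $c$ is a connected component of the subgraph formed by the edges of colour $c$.
   Formalization: The parameter ε ranges over the rationals. -}

module Defs where

open import Data.Nat using (ℕ)
open import Data.Integer using (+_)
open import Data.Rational using (ℚ; _/_; _*_; _-_; _<_; _≤_; 1ℚ)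
open import Data.Fin using (Fin)
open import Data.Fin.Subset using (Subset; _∈_; ∣_∣)
open import Data.Bool using (Bool; true)
open import Data.List using (length; filterᵇ; allFin)
open import Data.Sum using (_⊎_; inj₁; inj₂)
open import Data.Product using (_×_; Σ; ∃; ∃-syntax)
open import Data.Empty using (⊥)
open import Relation.Binary.PropositionalEquality using (_≡_)
open import Relation.Binary.Construct.Closure.ReflexiveTransitive using (Star)
open import Function.Bundles using (_⇔_)

-- A finite bipartite graph with biparts A = Fin m and B = Fin n,
-- given by its (decidable) edge relation.
record BipGraph (m n : ℕ) : Set where
  field
    edge : Fin m → Fin n → Bool

open BipGraph public

⟦_⟧ : ℕ → ℚ
⟦ k ⟧ = + k / 1

degA : ∀ {m n} → BipGraph m n → Fin m → ℕ
degA {m} {n} H x = length (filterᵇ (λ y → edge H x y) (allFin n))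

degB : ∀ {m n} → BipGraph m n → Fin n → ℕ
degB {m} {n} H y = length (filterᵇ (λ x → edge H x y) (allFin m))

CompleteDegree : ∀ {m n} → ℚ → BipGraph m n → Set
CompleteDegree {m} {n} γ H =
  (∀ (y : Fin n) → γ * ⟦ m ⟧ < ⟦ degB H y ⟧) ×
  (∀ (x : Fin m) → γ * ⟦ n ⟧ < ⟦ degA H x ⟧)

-- A 2-edge-colouring: every pair (x , y) gets a colour; only the colours of
-- actual edges matter.
Colouring : ℕ → ℕ → Set
Colouring m n = Fin m → Fin n → Fin 2

Vertex : ℕ → ℕ → Set
Vertex m n = Fin m ⊎ Fin n

data Adj {m n} (H : BipGraph m n) (χ : Colouring m n) (c : Fin 2)
     : Vertex m n → Vertex m n → Set where
  ab : ∀ {x y} → edge H x y ≡ true → χ x y ≡ c → Adj H χ c (inj₁ x) (inj₂ y)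
  ba : ∀ {x y} → edge H x y ≡ true → χ x y ≡ c → Adj H χ c (inj₂ y) (inj₁ x)

Conn : ∀ {m n} → BipGraph m n → Colouring m n → Fin 2 → Vertex m n → Vertex m n → Set
Conn H χ c = Star (Adj H χ c)

IsMonoComponent : ∀ {m n} → BipGraph m n → Colouring m n →
                  Fin 2 → Vertex m n → Subset m → Subset n → Set
IsMonoComponent {m} {n} H χ c v X Y =
  (∀ (x : Fin m) → (x ∈ X) ⇔ Conn H χ c v (inj₁ x)) ×
  (∀ (y : Fin n) → (y ∈ Y) ⇔ Conn H χ c v (inj₂ y))

Spanning : ℕ → ℕ → ℚ → ∀ {m' n'} → Subset m' → Subset n' → Set
Spanning m n γ X Y = (γ * ⟦ m ⟧ ≤ ⟦ ∣ X ∣ ⟧) × (γ * ⟦ n ⟧ ≤ ⟦ ∣ Y ∣ ⟧)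

-- Let δ = (1 − ε)/2 and fix x ∈ A. More than half of the more than (1 − ε)|B| edges at x share a
-- colour c, so the c-component C of x meets B in more than δ|B| vertices. If C also meets A in
-- at least δ|A| vertices we are done. Otherwise pick a c-neighbour y₀ of x and let D be the
-- component of y₀ in the other colour c′. Every edge from y₀ to A ∖ C has colour c′, so D meets A
-- in more than (1 − ε)|A| − δ|A| = δ|A| vertices. For every c-neighbour y of x, y and y₀ have more
-- than (1 − 2ε)|A| ≥ δ|A| > |C ∩ A| common neighbours (here ε ≤ 1/3 is used), hence one outside C;
-- both edges from it to y and y₀ leave C and so have colour c′, which puts y into D. Thus D also
-- meets B in more than δ|B| vertices.
module Submission where

open import Defs
open import Level using (Level)
open import Data.Nat as ℕ using (ℕ; zero; suc; z≤n; s≤s)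
import Data.Nat.Properties as ℕ
open import Data.Nat.Coprimality using (1-coprimeTo) renaming (sym to coprime-sym)
open import Data.Integer using (+_; +≤+)
import Data.Integer as ℤ
import Data.Integer.Properties as ℤ
open import Data.Rational
  using (ℚ; mkℚ; *≤*; _+_; _*_; _-_; -_; _/_; _<_; _≤_; 0ℚ; 1ℚ; ½; nonNegative)
open import Data.Rational.Properties
  using ( normalize-coprime; normalize-nonNeg; nonNegative⁻¹; nonNeg*nonNeg⇒nonNeg
        ; _<?_; _≤?_; ≮⇒≥; ≰⇒>; <-irrefl; <-asym; <-trans; <-≤-trans; ≤-<-trans; <⇒≤; ≤-trans
        ; +-mono-≤; +-mono-<; +-monoˡ-≤; +-monoʳ-≤; +-inverseʳ; +-identityʳ; module ≤-Reasoning)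
open import Data.Rational.Solver using (module +-*-Solver)
open import Data.Bool using (Bool; true; false)
import Data.Bool as Bool
open import Data.Fin using (Fin; zero; suc; splitAt; join)
import Data.Fin as Fin
open import Data.Fin.Properties using (splitAt-join; any?)
open import Data.Fin.Subset
  using (Subset; _∈_; _∉_; _⊆_; _∪_; _∩_; ∣_∣; ⁅_⁆; ⊥; Nonempty; outside; inside)
open import Data.Fin.Subset.Properties
  using ( _∈?_; x∈p∩q⁻; p⊆q⇒∣p∣≤∣q∣; p⊂q⇒∣p∣<∣q∣; ∣p∣≤n; ∣⊥∣≡0; p⊆p∪q; x∈p∪q⁺; x∈p∪q⁻
        ; x∈⁅x⁆; x∈⁅y⁆⇒x≡y)
open import Data.List using (length; filterᵇ)
import Data.List as List
open import Data.Vec using ([]; _∷_; tabulate)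
open import Data.Vec.Properties using (lookup∘tabulate; []=⇒lookup; lookup⇒[]=)
open import Data.Product using (_×_; _,_; proj₁; proj₂; ∃; ∃₂; ∃-syntax)
open import Data.Sum using (_⊎_; inj₁; inj₂; fromInj₂)
open import Data.Unit using (tt)
open import Function using (_∘_; case_of_)
open import Function.Bundles using (_⇔_; mk⇔)
open import Relation.Binary.Core using (Rel)
import Relation.Binary.Definitions as B
open import Relation.Binary.Construct.Closure.ReflexiveTransitive using (Star; _◅_; _◅◅_; gmap)
import Relation.Binary.Construct.Closure.ReflexiveTransitive as Star
open import Relation.Binary.PropositionalEquality
open import Relation.Nullary using (Dec; yes; no; does; contradiction)
import Relation.Nullary.Decidable as Dec
open import Relation.Nullary.Decidable using (toWitness)
open import Relation.Unary using (Pred; Decidable)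

private
  variable
    ℓ : Level
    n : ℕ

-- Subsets of Fin n

∈-tabulate⁺ : (f : Fin n → Bool) {i : Fin n} → f i ≡ true → i ∈ tabulate f
∈-tabulate⁺ f {i} fi = lookup⇒[]= i (tabulate f) (trans (lookup∘tabulate f i) fi)

∈-tabulate⁻ : (f : Fin n → Bool) {i : Fin n} → i ∈ tabulate f → f i ≡ true
∈-tabulate⁻ f {i} i∈ = trans (sym (lookup∘tabulate f i)) ([]=⇒lookup i∈)

subset : {P : Pred (Fin n) ℓ} → Decidable P → Subset n
subset P? = tabulate (does ∘ P?)

module _ {P : Pred (Fin n) ℓ} (P? : Decidable P) {i : Fin n} where

  ∈-subset⁺ : P i → i ∈ subset P?
  ∈-subset⁺ Pi with P? i | ∈-tabulate⁺ (does ∘ P?) {i}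
  ... | yes _  | i∈ = i∈ refl
  ... | no ¬Pi | _  = contradiction Pi ¬Pi

  ∈-subset⁻ : i ∈ subset P? → P i
  ∈-subset⁻ i∈ with P? i | ∈-tabulate⁻ (does ∘ P?) i∈
  ... | yes Pi | _ = Pi

length-filterᵇ-tabulate : ∀ {k} (f : Fin k → Bool) (g : Fin n → Fin k) →
                          length (filterᵇ f (List.tabulate g)) ≡ ∣ tabulate (f ∘ g) ∣
length-filterᵇ-tabulate {n = zero}  f g = refl
length-filterᵇ-tabulate {n = suc n} f g with f (g zero)
... | true  = cong suc (length-filterᵇ-tabulate f (g ∘ suc))
... | false = length-filterᵇ-tabulate f (g ∘ suc)

∣p∪q∣≤∣p∣+∣q∣ : (p q : Subset n) → ∣ p ∪ q ∣ ℕ.≤ ∣ p ∣ ℕ.+ ∣ q ∣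
∣p∪q∣≤∣p∣+∣q∣ []            []            = z≤n
∣p∪q∣≤∣p∣+∣q∣ (outside ∷ p) (outside ∷ q) = ∣p∪q∣≤∣p∣+∣q∣ p q
∣p∪q∣≤∣p∣+∣q∣ (outside ∷ p) (inside  ∷ q) =
  subst (suc ∣ p ∪ q ∣ ℕ.≤_) (sym (ℕ.+-suc ∣ p ∣ ∣ q ∣)) (s≤s (∣p∪q∣≤∣p∣+∣q∣ p q))
∣p∪q∣≤∣p∣+∣q∣ (inside  ∷ p) (outside ∷ q) = s≤s (∣p∪q∣≤∣p∣+∣q∣ p q)
∣p∪q∣≤∣p∣+∣q∣ (inside  ∷ p) (inside  ∷ q) =
  s≤s (ℕ.≤-trans (∣p∪q∣≤∣p∣+∣q∣ p q) (ℕ.+-monoʳ-≤ ∣ p ∣ (ℕ.n≤1+n ∣ q ∣)))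

∣p∣+∣q∣≤n+∣p∩q∣ : (p q : Subset n) → ∣ p ∣ ℕ.+ ∣ q ∣ ℕ.≤ n ℕ.+ ∣ p ∩ q ∣
∣p∣+∣q∣≤n+∣p∩q∣ []            []            = z≤n
∣p∣+∣q∣≤n+∣p∩q∣ (outside ∷ p) (outside ∷ q) = ℕ.m≤n⇒m≤1+n (∣p∣+∣q∣≤n+∣p∩q∣ p q)
∣p∣+∣q∣≤n+∣p∩q∣ {suc n} (outside ∷ p) (inside ∷ q) =
  subst (ℕ._≤ suc (n ℕ.+ ∣ p ∩ q ∣)) (sym (ℕ.+-suc ∣ p ∣ ∣ q ∣)) (s≤s (∣p∣+∣q∣≤n+∣p∩q∣ p q))
∣p∣+∣q∣≤n+∣p∩q∣ (inside  ∷ p) (outside ∷ q) = s≤s (∣p∣+∣q∣≤n+∣p∩q∣ p q)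
∣p∣+∣q∣≤n+∣p∩q∣ {suc n} (inside ∷ p) (inside ∷ q) =
  s≤s (subst₂ ℕ._≤_ (sym (ℕ.+-suc ∣ p ∣ ∣ q ∣)) (sym (ℕ.+-suc n ∣ p ∩ q ∣))
                    (s≤s (∣p∣+∣q∣≤n+∣p∩q∣ p q)))

∣q∣<∣p∣⇒∃∈p∉q : (p q : Subset n) → ∣ q ∣ ℕ.< ∣ p ∣ → ∃[ i ] i ∈ p × i ∉ q
∣q∣<∣p∣⇒∃∈p∉q p q ∣q∣<∣p∣ with any? (λ i → i ∈? p Dec.×-dec Dec.¬? (i ∈? q))
... | yes witness = witness
... | no ∄        = contradiction (p⊆q⇒∣p∣≤∣q∣ p⊆q) (ℕ.<⇒≱ ∣q∣<∣p∣)
  where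
  p⊆q : p ⊆ q
  p⊆q {i} i∈p with i ∈? q
  ... | yes i∈q = i∈q
  ... | no  i∉q = contradiction (i , i∈p , i∉q) ∄

0<∣p∣⇒Nonempty : (p : Subset n) → 0 ℕ.< ∣ p ∣ → Nonempty p
0<∣p∣⇒Nonempty {n} p 0<∣p∣ with ∣q∣<∣p∣⇒∃∈p∉q p ⊥ (subst (ℕ._< ∣ p ∣) (sym (∣⊥∣≡0 n)) 0<∣p∣)
... | i , i∈p , _ = i , i∈p

∣p∣<∣p∪⁅x⁆∣ : {p : Subset n} {x : Fin n} → x ∉ p → ∣ p ∣ ℕ.< ∣ p ∪ ⁅ x ⁆ ∣
∣p∣<∣p∪⁅x⁆∣ {p = p} {x} x∉p = p⊂q⇒∣p∣<∣q∣ (p⊆p∪q ⁅ x ⁆ , x , x∈p∪q⁺ (inj₂ (x∈⁅x⁆ x)) , x∉p)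

-- Reachability in a finite graph

module Reachability {N : ℕ} {R : Rel (Fin N) ℓ} (R? : B.Decidable R) (v : Fin N) where

  Closed : Subset N → Set ℓ
  Closed S = ∀ {i j} → i ∈ S → R i j → j ∈ S

  Reachable : Subset N → Set ℓ
  Reachable S = ∀ {j} → j ∈ S → Star R v j

  closed-or-exit : (S : Subset N) → Closed S ⊎ ∃₂ λ i j → i ∈ S × j ∉ S × R i j
  closed-or-exit S with any? (λ i → any? (λ j → i ∈? S Dec.×-dec Dec.¬? (j ∈? S) Dec.×-dec R? i j))
  ... | yes exit = inj₂ exit
  ... | no ∄exit = inj₁ closed
    where
    closed : Closed S
    closed {i} {j} i∈S Rij with j ∈? S
    ... | yes j∈S = j∈S
    ... | no  j∉S = contradiction (i , j , i∈S , j∉S , Rij) ∄exit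

  closed-star : ∀ {S i j} → Closed S → i ∈ S → Star R i j → j ∈ S
  closed-star closed i∈S Star.ε     = i∈S
  closed-star closed i∈S (Rij ◅ js) = closed-star closed (closed i∈S Rij) js

  -- k is fuel: every exit edge adds a vertex to S, which can happen at most N − ∣ S ∣ times.
  saturate : ∀ k S → N ℕ.≤ k ℕ.+ ∣ S ∣ → Reachable S → ∃[ T ] S ⊆ T × Closed T × Reachable T
  saturate k S bound reach with closed-or-exit S
  ... | inj₁ closed = S , (λ i∈S → i∈S) , closed , reach
  ... | inj₂ (i , j , i∈S , j∉S , Rij) = continue k bound
    where
    S′ = S ∪ ⁅ j ⁆

    reach′ : Reachable S′
    reach′ {j′} j′∈S′ with x∈p∪q⁻ S ⁅ j ⁆ j′∈S′
    ... | inj₁ j′∈S   = reach j′∈S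
    ... | inj₂ j′∈⁅j⁆ rewrite x∈⁅y⁆⇒x≡y j j′∈⁅j⁆ = reach i∈S ◅◅ (Rij ◅ Star.ε)

    ∣S∣<∣S′∣ : ∣ S ∣ ℕ.< ∣ S′ ∣
    ∣S∣<∣S′∣ = ∣p∣<∣p∪⁅x⁆∣ j∉S

    continue : ∀ k → N ℕ.≤ k ℕ.+ ∣ S ∣ → ∃[ T ] S ⊆ T × Closed T × Reachable T
    continue zero    bound = contradiction (ℕ.≤-trans (∣p∣≤n S′) bound) (ℕ.<⇒≱ ∣S∣<∣S′∣)
    continue (suc k) bound =
      let T , S′⊆T , closed , reachT = saturate k S′ bound′ reach′
      in  T , S′⊆T ∘ p⊆p∪q ⁅ j ⁆ , closed , reachT
      where
      bound′ : N ℕ.≤ k ℕ.+ ∣ S′ ∣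
      bound′ = ℕ.≤-trans bound
        (subst (ℕ._≤ k ℕ.+ ∣ S′ ∣) (ℕ.+-suc k ∣ S ∣) (ℕ.+-monoʳ-≤ k ∣S∣<∣S′∣))

  reachable? : ∀ w → Dec (Star R v w)
  reachable? w =
    let T , ⁅v⁆⊆T , closed , reach = saturate N ⁅ v ⁆ (ℕ.m≤m+n N ∣ ⁅ v ⁆ ∣) reach⁅v⁆
    in  Dec.map′ reach (closed-star closed (⁅v⁆⊆T (x∈⁅x⁆ v))) (w ∈? T)
    where
    reach⁅v⁆ : Reachable ⁅ v ⁆
    reach⁅v⁆ j∈⁅v⁆ rewrite x∈⁅y⁆⇒x≡y v j∈⁅v⁆ = Star.ε

module _ {a b} {A : Set a} {B : Set b} {R : Rel B ℓ} (f : A → B) (g : B → A)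
         (f∘g≗id : ∀ y → f (g y) ≡ y) where

  star-retract : ∀ {u w} → Star (λ i j → R (f i) (f j)) (g u) (g w) ⇔ Star R u w
  star-retract {u} {w} =
    mk⇔ (subst₂ (Star R) (f∘g≗id u) (f∘g≗id w) ∘ gmap f (λ r → r))
        (gmap g (λ {u} {w} r → subst₂ R (sym (f∘g≗id u)) (sym (f∘g≗id w)) r))

other : Fin 2 → Fin 2
other zero       = suc zero
other (suc zero) = zero

≢⇒≡other : ∀ {a c : Fin 2} → a ≢ c → a ≡ other c
≢⇒≡other {zero}     {zero}     a≢c = contradiction refl a≢c
≢⇒≡other {zero}     {suc zero} _   = refl
≢⇒≡other {suc zero} {zero}     _   = refl
≢⇒≡other {suc zero} {suc zero} a≢c = contradiction refl a≢c

⊎⇒∃-Fin2 : ∀ {p} {P : Fin 2 → Set p} → P zero ⊎ P (suc zero) → ∃ P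
⊎⇒∃-Fin2 (inj₁ P0) = zero , P0
⊎⇒∃-Fin2 (inj₂ P1) = suc zero , P1

-- Monochromatic components and neighbourhoods

module MonochromaticComponents {m n} (H : BipGraph m n) (χ : Colouring m n) where

  adj? : ∀ c → B.Decidable (Adj H χ c)
  adj? c (inj₁ x) (inj₂ y) = Dec.map′ (λ (e , col) → ab e col) (λ { (ab e col) → e , col })
                                      ((edge H x y Bool.≟ true) Dec.×-dec (χ x y Fin.≟ c))
  adj? c (inj₂ y) (inj₁ x) = Dec.map′ (λ (e , col) → ba e col) (λ { (ba e col) → e , col })
                                      ((edge H x y Bool.≟ true) Dec.×-dec (χ x y Fin.≟ c))
  adj? c (inj₁ _) (inj₁ _) = no λ ()
  adj? c (inj₂ _) (inj₂ _) = no λ ()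

  conn? : ∀ c → B.Decidable (Conn H χ c)
  conn? c u w = Dec.map (star-retract (splitAt m) (join m n) (splitAt-join m n))
    (Reachability.reachable? (λ i j → adj? c (splitAt m i) (splitAt m j)) (join m n u) (join m n w))

  -- Opaque, so that a vertex set determines its colour and base vertex during unification.
  opaque
    componentᴬ : Fin 2 → Vertex m n → Subset m
    componentᴬ c v = subset (λ x → conn? c v (inj₁ x))

    componentᴮ : Fin 2 → Vertex m n → Subset n
    componentᴮ c v = subset (λ y → conn? c v (inj₂ y))

    ∈-componentᴬ⁺ : ∀ {c v x} → Conn H χ c v (inj₁ x) → x ∈ componentᴬ c v
    ∈-componentᴬ⁺ {c} {v} = ∈-subset⁺ (λ x → conn? c v (inj₁ x))

    ∈-componentᴬ⁻ : ∀ {c v x} → x ∈ componentᴬ c v → Conn H χ c v (inj₁ x)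
    ∈-componentᴬ⁻ {c} {v} = ∈-subset⁻ (λ x → conn? c v (inj₁ x))

    ∈-componentᴮ⁺ : ∀ {c v y} → Conn H χ c v (inj₂ y) → y ∈ componentᴮ c v
    ∈-componentᴮ⁺ {c} {v} = ∈-subset⁺ (λ y → conn? c v (inj₂ y))

    ∈-componentᴮ⁻ : ∀ {c v y} → y ∈ componentᴮ c v → Conn H χ c v (inj₂ y)
    ∈-componentᴮ⁻ {c} {v} = ∈-subset⁻ (λ y → conn? c v (inj₂ y))

    colourNbrᴬ : Fin 2 → Fin m → Subset n
    colourNbrᴬ c x = subset (λ y → adj? c (inj₁ x) (inj₂ y))

    colourNbrᴮ : Fin 2 → Fin n → Subset m
    colourNbrᴮ c y = subset (λ x → adj? c (inj₂ y) (inj₁ x))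

    ∈-colourNbrᴬ⁺ : ∀ {c x y} → Adj H χ c (inj₁ x) (inj₂ y) → y ∈ colourNbrᴬ c x
    ∈-colourNbrᴬ⁺ {c} {x} = ∈-subset⁺ (λ y → adj? c (inj₁ x) (inj₂ y))

    ∈-colourNbrᴬ⁻ : ∀ {c x y} → y ∈ colourNbrᴬ c x → Adj H χ c (inj₁ x) (inj₂ y)
    ∈-colourNbrᴬ⁻ {c} {x} = ∈-subset⁻ (λ y → adj? c (inj₁ x) (inj₂ y))

    ∈-colourNbrᴮ⁺ : ∀ {c x y} → Adj H χ c (inj₂ y) (inj₁ x) → x ∈ colourNbrᴮ c y
    ∈-colourNbrᴮ⁺ {c} {y = y} = ∈-subset⁺ (λ x → adj? c (inj₂ y) (inj₁ x))

    ∈-colourNbrᴮ⁻ : ∀ {c x y} → x ∈ colourNbrᴮ c y → Adj H χ c (inj₂ y) (inj₁ x)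
    ∈-colourNbrᴮ⁻ {c} {y = y} = ∈-subset⁻ (λ x → adj? c (inj₂ y) (inj₁ x))

  isMonoComponent-component : ∀ c v → IsMonoComponent H χ c v (componentᴬ c v) (componentᴮ c v)
  isMonoComponent-component c v = (λ x → mk⇔ ∈-componentᴬ⁻ ∈-componentᴬ⁺)
                                , (λ y → mk⇔ ∈-componentᴮ⁻ ∈-componentᴮ⁺)

  nbrᴬ : Fin m → Subset n
  nbrᴬ x = tabulate (edge H x)

  nbrᴮ : Fin n → Subset m
  nbrᴮ y = tabulate (λ x → edge H x y)

  ∣nbrᴬ∣≡degA : ∀ x → ∣ nbrᴬ x ∣ ≡ degA H x
  ∣nbrᴬ∣≡degA x = sym (length-filterᵇ-tabulate (edge H x) (λ y → y))

  ∣nbrᴮ∣≡degB : ∀ y → ∣ nbrᴮ y ∣ ≡ degB H y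
  ∣nbrᴮ∣≡degB y = sym (length-filterᵇ-tabulate (λ x → edge H x y) (λ x → x))

  nbrᴬ⊆colourNbrᴬ∪ : ∀ c x → nbrᴬ x ⊆ colourNbrᴬ c x ∪ colourNbrᴬ (other c) x
  nbrᴬ⊆colourNbrᴬ∪ c x {y} y∈ with χ x y Fin.≟ c
  ... | yes χ≡c = x∈p∪q⁺ (inj₁ (∈-colourNbrᴬ⁺ (ab (∈-tabulate⁻ _ y∈) χ≡c)))
  ... | no  χ≢c = x∈p∪q⁺ (inj₂ (∈-colourNbrᴬ⁺ (ab (∈-tabulate⁻ _ y∈) (≢⇒≡other χ≢c))))

  ∣nbrᴬ∣≤∣colourNbrᴬ∣+∣colourNbrᴬ∣ : ∀ c x →
    ∣ nbrᴬ x ∣ ℕ.≤ ∣ colourNbrᴬ c x ∣ ℕ.+ ∣ colourNbrᴬ (other c) x ∣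
  ∣nbrᴬ∣≤∣colourNbrᴬ∣+∣colourNbrᴬ∣ c x =
    ℕ.≤-trans (p⊆q⇒∣p∣≤∣q∣ (nbrᴬ⊆colourNbrᴬ∪ c x))
              (∣p∪q∣≤∣p∣+∣q∣ (colourNbrᴬ c x) (colourNbrᴬ (other c) x))

  colourNbrᴬ⊆componentᴮ : ∀ c x → colourNbrᴬ c x ⊆ componentᴮ c (inj₁ x)
  colourNbrᴬ⊆componentᴮ c x y∈ = ∈-componentᴮ⁺ (∈-colourNbrᴬ⁻ y∈ ◅ Star.ε)

  colourNbrᴮ⊆componentᴬ : ∀ c y → colourNbrᴮ c y ⊆ componentᴬ c (inj₂ y)
  colourNbrᴮ⊆componentᴬ c y x∈ = ∈-componentᴬ⁺ (∈-colourNbrᴮ⁻ x∈ ◅ Star.ε)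

  exit-edge-colour : ∀ {c v x y} → y ∈ componentᴮ c v → edge H x y ≡ true →
                     x ∉ componentᴬ c v → χ x y ≡ other c
  exit-edge-colour {c} {v} {x} {y} y∈C e x∉C with χ x y Fin.≟ c
  ... | yes χ≡c = contradiction (∈-componentᴬ⁺ (∈-componentᴮ⁻ y∈C ◅◅ (ba e χ≡c ◅ Star.ε))) x∉C
  ... | no  χ≢c = ≢⇒≡other χ≢c

  nbrᴮ⊆componentᴬ∪colourNbrᴮ : ∀ {c v y} → y ∈ componentᴮ c v →
                               nbrᴮ y ⊆ componentᴬ c v ∪ colourNbrᴮ (other c) y
  nbrᴮ⊆componentᴬ∪colourNbrᴮ {c} {v} y∈C {x} x∈ with x ∈? componentᴬ c v
  ... | yes x∈C = x∈p∪q⁺ (inj₁ x∈C)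
  ... | no  x∉C = x∈p∪q⁺ (inj₂ (∈-colourNbrᴮ⁺ (ba e (exit-edge-colour y∈C e x∉C))))
    where
    e = ∈-tabulate⁻ _ x∈

  ∣nbrᴮ∣≤∣componentᴬ∣+∣colourNbrᴮ∣ : ∀ {c v y} → y ∈ componentᴮ c v →
    ∣ nbrᴮ y ∣ ℕ.≤ ∣ componentᴬ c v ∣ ℕ.+ ∣ colourNbrᴮ (other c) y ∣
  ∣nbrᴮ∣≤∣componentᴬ∣+∣colourNbrᴮ∣ {c} {v} {y} y∈C =
    ℕ.≤-trans (p⊆q⇒∣p∣≤∣q∣ (nbrᴮ⊆componentᴬ∪colourNbrᴮ y∈C))
              (∣p∪q∣≤∣p∣+∣q∣ (componentᴬ c v) (colourNbrᴮ (other c) y))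

  common-exit⇒component-other : ∀ {c v x y y₀} → y₀ ∈ componentᴮ c v → y ∈ componentᴮ c v →
                                x ∈ nbrᴮ y ∩ nbrᴮ y₀ → x ∉ componentᴬ c v →
                                y ∈ componentᴮ (other c) (inj₂ y₀)
  common-exit⇒component-other {y = y} {y₀} y₀∈C y∈C x∈ x∉C with x∈p∩q⁻ (nbrᴮ y) (nbrᴮ y₀) x∈
  ... | x∈nbr-y , x∈nbr-y₀ =
    ∈-componentᴮ⁺ (ba e₀ (exit-edge-colour y₀∈C e₀ x∉C) ◅ ab e (exit-edge-colour y∈C e x∉C) ◅ Star.ε)
    where
    e  = ∈-tabulate⁻ _ x∈nbr-y
    e₀ = ∈-tabulate⁻ _ x∈nbr-y₀

-- Rational arithmetic

⟦_⟧≡mkℚ : ∀ k → ⟦ k ⟧ ≡ mkℚ (+ k) 0 (coprime-sym (1-coprimeTo k))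
⟦ k ⟧≡mkℚ = normalize-coprime (coprime-sym (1-coprimeTo k))

⟦⟧-mono-≤ : ∀ {k l} → k ℕ.≤ l → ⟦ k ⟧ ≤ ⟦ l ⟧
⟦⟧-mono-≤ {k} {l} k≤l rewrite ⟦ k ⟧≡mkℚ | ⟦ l ⟧≡mkℚ =
  *≤* (subst₂ ℤ._≤_ (sym (ℤ.*-identityʳ (+ k))) (sym (ℤ.*-identityʳ (+ l))) (+≤+ k≤l))

⟦⟧-cancel-< : ∀ {k l} → ⟦ k ⟧ < ⟦ l ⟧ → k ℕ.< l
⟦⟧-cancel-< ⟦k⟧<⟦l⟧ = ℕ.≰⇒> λ l≤k → <-irrefl refl (<-≤-trans ⟦k⟧<⟦l⟧ (⟦⟧-mono-≤ l≤k))

⟦⟧-+ : ∀ k l → ⟦ k ℕ.+ l ⟧ ≡ ⟦ k ⟧ + ⟦ l ⟧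
⟦⟧-+ k l rewrite ⟦ k ⟧≡mkℚ | ⟦ l ⟧≡mkℚ | ℤ.*-identityʳ (+ k) | ℤ.*-identityʳ (+ l) = refl

<⟦⟧-weaken : ∀ {q k l} → q < ⟦ k ⟧ → k ℕ.≤ l → q ≤ ⟦ l ⟧
<⟦⟧-weaken q<k k≤l = <⇒≤ (<-≤-trans q<k (⟦⟧-mono-≤ k≤l))

⟦⟧-nonNeg : ∀ k → 0ℚ ≤ ⟦ k ⟧
⟦⟧-nonNeg k = nonNegative⁻¹ ⟦ k ⟧ {{normalize-nonNeg k 1}}

*-nonNeg : ∀ {p q} → 0ℚ ≤ p → 0ℚ ≤ q → 0ℚ ≤ p * q
*-nonNeg {p} {q} 0≤p 0≤q =
  nonNegative⁻¹ (p * q) {{nonNeg*nonNeg⇒nonNeg p {{nonNegative 0≤p}} q {{nonNegative 0≤q}}}}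

p≤q⇒0≤q-p : ∀ {p q} → p ≤ q → 0ℚ ≤ q - p
p≤q⇒0≤q-p {p} {q} p≤q = subst (_≤ q - p) (+-inverseʳ p) (+-monoˡ-≤ (- p) p≤q)

+-cancelˡ-< : ∀ p {q r} → p + q < p + r → q < r
+-cancelˡ-< p {q} {r} p+q<p+r with q <? r
... | yes q<r = q<r
... | no  q≮r = contradiction (<-≤-trans p+q<p+r (+-monoʳ-≤ p (≮⇒≥ q≮r))) (<-irrefl refl)

x+x<y+z⇒x<y⊎x<z : ∀ {x y z} → x + x < y + z → x < y ⊎ x < z
x+x<y+z⇒x<y⊎x<z {x} {y} {z} x+x<y+z with x <? y | x <? z
... | yes x<y | _       = inj₁ x<y
... | no  _   | yes x<z = inj₂ x<z
... | no  x≮y | no  x≮z =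
  contradiction (<-≤-trans x+x<y+z (+-mono-≤ (≮⇒≥ x≮y) (≮⇒≥ x≮z))) (<-irrefl refl)

-- The natural-number arguments are explicit: they occur only under ⟦_⟧ and _+_, which Agda
-- cannot invert.
module DegreeArithmetic (ε : ℚ) (ε≤1/5 : ε ≤ + 1 / 5) where

  open +-*-Solver using (solve; _:+_; _:*_; _:-_; _:=_; con)

  g δ : ℚ
  g = 1ℚ - ε
  δ = g * ½

  0≤½ : 0ℚ ≤ ½
  0≤½ = toWitness {a? = 0ℚ ≤? ½} tt

  ε≤1 : ε ≤ 1ℚ
  ε≤1 = ≤-trans ε≤1/5 (toWitness {a? = + 1 / 5 ≤? 1ℚ} tt)

  3ε≤1 : ε + (ε + ε) ≤ 1ℚ
  3ε≤1 = ≤-trans (+-mono-≤ ε≤1/5 (+-mono-≤ ε≤1/5 ε≤1/5))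
                 (toWitness {a? = + 1 / 5 + (+ 1 / 5 + + 1 / 5) ≤? 1ℚ} tt)

  δ-nonNeg : 0ℚ ≤ δ
  δ-nonNeg = *-nonNeg (p≤q⇒0≤q-p ε≤1) 0≤½

  g*-halves : ∀ x → g * x ≡ δ * x + δ * x
  g*-halves = solve 2 (λ ε x → (con 1ℚ :- ε) :* x
                             := ((con 1ℚ :- ε) :* con ½) :* x :+ ((con 1ℚ :- ε) :* con ½) :* x) refl ε

  half-pigeonhole : ∀ {x} d k l → g * x < ⟦ d ⟧ → d ℕ.≤ k ℕ.+ l → δ * x < ⟦ k ⟧ ⊎ δ * x < ⟦ l ⟧
  half-pigeonhole {x} d k l gx<d d≤k+l = x+x<y+z⇒x<y⊎x<z (begin-strict
    δ * x + δ * x   ≡⟨ sym (g*-halves x) ⟩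
    g * x           <⟨ gx<d ⟩
    ⟦ d ⟧           ≤⟨ ⟦⟧-mono-≤ d≤k+l ⟩
    ⟦ k ℕ.+ l ⟧     ≡⟨ ⟦⟧-+ k l ⟩
    ⟦ k ⟧ + ⟦ l ⟧   ∎)
    where open ≤-Reasoning

  codegree-bound : ∀ a d₁ d₂ t → g * ⟦ a ⟧ < ⟦ d₁ ⟧ → g * ⟦ a ⟧ < ⟦ d₂ ⟧ →
                   d₁ ℕ.+ d₂ ℕ.≤ a ℕ.+ t → δ * ⟦ a ⟧ < ⟦ t ⟧
  codegree-bound a d₁ d₂ t ga<d₁ ga<d₂ d₁+d₂≤a+t = +-cancelˡ-< ⟦ a ⟧ (begin-strict
    ⟦ a ⟧ + δ * ⟦ a ⟧         ≤⟨ a+δa≤ga+ga ⟩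
    g * ⟦ a ⟧ + g * ⟦ a ⟧     <⟨ +-mono-< ga<d₁ ga<d₂ ⟩
    ⟦ d₁ ⟧ + ⟦ d₂ ⟧           ≡⟨ sym (⟦⟧-+ d₁ d₂) ⟩
    ⟦ d₁ ℕ.+ d₂ ⟧             ≤⟨ ⟦⟧-mono-≤ d₁+d₂≤a+t ⟩
    ⟦ a ℕ.+ t ⟧               ≡⟨ ⟦⟧-+ a t ⟩
    ⟦ a ⟧ + ⟦ t ⟧             ∎)
    where
    open ≤-Reasoning

    -- The slack (1 − 3ε)/2 · a is nonnegative as ε ≤ 1/3: this is where the bound on ε enters.
    slack : ∀ A → (A + δ * A) + ((1ℚ - (ε + (ε + ε))) * ½) * A ≡ g * A + g * A
    slack = solve 2 (λ ε A → (A :+ ((con 1ℚ :- ε) :* con ½) :* A)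
                             :+ ((con 1ℚ :- (ε :+ (ε :+ ε))) :* con ½) :* A
                           := (con 1ℚ :- ε) :* A :+ (con 1ℚ :- ε) :* A) refl ε

    a+δa≤ga+ga : ⟦ a ⟧ + δ * ⟦ a ⟧ ≤ g * ⟦ a ⟧ + g * ⟦ a ⟧
    a+δa≤ga+ga = subst₂ _≤_ (+-identityʳ _) (slack ⟦ a ⟧)
      (+-monoʳ-≤ (⟦ a ⟧ + δ * ⟦ a ⟧) (*-nonNeg (*-nonNeg (p≤q⇒0≤q-p 3ε≤1) 0≤½) (⟦⟧-nonNeg a)))

-- The two candidate components

module SpanningComponent (ε : ℚ) (ε≤1/5 : ε ≤ + 1 / 5) {m n : ℕ} (H : BipGraph (suc m) n)
                         (χ : Colouring (suc m) n) (deg> : CompleteDegree (1ℚ - ε) H) where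

  open DegreeArithmetic ε ε≤1/5
  open MonochromaticComponents H χ

  degB> : ∀ y → g * ⟦ suc m ⟧ < ⟦ ∣ nbrᴮ y ∣ ⟧
  degB> y = subst (λ d → g * ⟦ suc m ⟧ < ⟦ d ⟧) (sym (∣nbrᴮ∣≡degB y)) (proj₁ deg> y)

  degA> : ∀ x → g * ⟦ n ⟧ < ⟦ ∣ nbrᴬ x ∣ ⟧
  degA> x = subst (λ d → g * ⟦ n ⟧ < ⟦ d ⟧) (sym (∣nbrᴬ∣≡degA x)) (proj₂ deg> x)

  Spans : Fin 2 → Vertex (suc m) n → Set
  Spans c v = Spanning (suc m) n δ (componentᴬ c v) (componentᴮ c v)

  SpanningMonoComponent : Set
  SpanningMonoComponent =
    ∃[ c ] ∃[ v ] ∃[ X ] ∃[ Y ] (IsMonoComponent H χ c v X Y × Spanning (suc m) n δ X Y)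

  spans⇒spanningMonoComponent : ∀ c v → Spans c v → SpanningMonoComponent
  spans⇒spanningMonoComponent c v spans =
    c , v , componentᴬ c v , componentᴮ c v , isMonoComponent-component c v , spans

  heavy-colour : ∀ x → ∃[ c ] δ * ⟦ n ⟧ < ⟦ ∣ colourNbrᴬ c x ∣ ⟧
  heavy-colour x = ⊎⇒∃-Fin2
    (half-pigeonhole (∣ nbrᴬ x ∣) (∣ colourNbrᴬ zero x ∣) (∣ colourNbrᴬ (suc zero) x ∣)
                     (degA> x) (∣nbrᴬ∣≤∣colourNbrᴬ∣+∣colourNbrᴬ∣ zero x))

  colourNbrᴬ-nonempty : ∀ {c x} → δ * ⟦ n ⟧ < ⟦ ∣ colourNbrᴬ c x ∣ ⟧ → Nonempty (colourNbrᴬ c x)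
  colourNbrᴬ-nonempty {c} {x} heavy =
    0<∣p∣⇒Nonempty (colourNbrᴬ c x) (⟦⟧-cancel-< (≤-<-trans (*-nonNeg δ-nonNeg (⟦⟧-nonNeg n)) heavy))

  heavy-colour-spansᴮ : ∀ {c x} → δ * ⟦ n ⟧ < ⟦ ∣ colourNbrᴬ c x ∣ ⟧ →
                        δ * ⟦ n ⟧ ≤ ⟦ ∣ componentᴮ c (inj₁ x) ∣ ⟧
  heavy-colour-spansᴮ {c} {x} heavy = <⟦⟧-weaken heavy (p⊆q⇒∣p∣≤∣q∣ (colourNbrᴬ⊆componentᴮ c x))

  other-colour-spans : ∀ {c x y₀} → ⟦ ∣ componentᴬ c (inj₁ x) ∣ ⟧ < δ * ⟦ suc m ⟧ →
                       δ * ⟦ n ⟧ < ⟦ ∣ colourNbrᴬ c x ∣ ⟧ → y₀ ∈ colourNbrᴬ c x →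
                       Spans (other c) (inj₂ y₀)
  other-colour-spans {c} {x} {y₀} small heavy y₀∈ = spansᴬ , <⟦⟧-weaken heavy (p⊆q⇒∣p∣≤∣q∣ reach)
    where
    C = componentᴬ c (inj₁ x)
    y₀∈C = colourNbrᴬ⊆componentᴮ c x y₀∈

    spansᴬ : δ * ⟦ suc m ⟧ ≤ ⟦ ∣ componentᴬ (other c) (inj₂ y₀) ∣ ⟧
    spansᴬ = <⟦⟧-weaken
      (fromInj₂ (λ δa<∣C∣ → contradiction δa<∣C∣ (<-asym small))
        (half-pigeonhole (∣ nbrᴮ y₀ ∣) (∣ C ∣) (∣ colourNbrᴮ (other c) y₀ ∣)
                         (degB> y₀) (∣nbrᴮ∣≤∣componentᴬ∣+∣colourNbrᴮ∣ y₀∈C)))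
      (p⊆q⇒∣p∣≤∣q∣ (colourNbrᴮ⊆componentᴬ (other c) y₀))

    reach : colourNbrᴬ c x ⊆ componentᴮ (other c) (inj₂ y₀)
    reach {y} y∈ =
      let z , z∈common , z∉C = ∣q∣<∣p∣⇒∃∈p∉q (nbrᴮ y ∩ nbrᴮ y₀) C ∣C∣<∣common∣
      in  common-exit⇒component-other y₀∈C (colourNbrᴬ⊆componentᴮ c x y∈) z∈common z∉C
      where
      ∣C∣<∣common∣ : ∣ C ∣ ℕ.< ∣ nbrᴮ y ∩ nbrᴮ y₀ ∣
      ∣C∣<∣common∣ = ⟦⟧-cancel-< (<-trans small
        (codegree-bound (suc m) (∣ nbrᴮ y ∣) (∣ nbrᴮ y₀ ∣) (∣ nbrᴮ y ∩ nbrᴮ y₀ ∣)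
                        (degB> y) (degB> y₀) (∣p∣+∣q∣≤n+∣p∩q∣ (nbrᴮ y) (nbrᴮ y₀))))

lemma13 : (ε : ℚ) → 0ℚ < ε → ε ≤ + 1 / 5 →
          (m n : ℕ) → (H : BipGraph (suc m) n) →
          CompleteDegree (1ℚ - ε) H →
          (χ : Colouring (suc m) n) →
          ∃[ c ] ∃[ v ] ∃[ X ] ∃[ Y ]
            (IsMonoComponent H χ c v X Y ×
             Spanning (suc m) n ((1ℚ - ε) * (+ 1 / 2)) X Y)
lemma13 ε _ ε≤1/5 m n H deg> χ = from-heavy-colour (heavy-colour zero)
  where
  open DegreeArithmetic ε ε≤1/5
  open MonochromaticComponents H χ
  open SpanningComponent ε ε≤1/5 H χ deg>

  from-heavy-colour : ∃[ c ] δ * ⟦ n ⟧ < ⟦ ∣ colourNbrᴬ c zero ∣ ⟧ → SpanningMonoComponent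
  from-heavy-colour (c , heavy) = case δ * ⟦ suc m ⟧ ≤? ⟦ ∣ componentᴬ c (inj₁ zero) ∣ ⟧ of λ where
    (yes spansᴬ) → spans⇒spanningMonoComponent c (inj₁ zero) (spansᴬ , heavy-colour-spansᴮ heavy)
    (no ¬spansᴬ) → let y₀ , y₀∈ = colourNbrᴬ-nonempty heavy
                   in  spans⇒spanningMonoComponent (other c) (inj₂ y₀)
                         (other-colour-spans (≰⇒> ¬spansᴬ) heavy y₀∈)
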